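{- For every ordinal $\alpha$ with $0<\alpha<\varepsilon_0$, $\mathbf{A}_\alpha=\mathbf{F}_\alpha$, where $$\mathbf{A}_\alpha=\bigcup_{p\in\mathscr F_{<\alpha}}\mathrm{DTime}\big(A_\alpha(p(n))\big),\qquad \mathbf{F}_\alpha=\bigcup_{p\in\mathscr F_{<\alpha}}\mathrm{DTime}\big(F_\alpha(p(n))\big).$$
   Context: Ordinals are below $\varepsilon_0$ and written in Cantor normal form $\alpha=\omega^{\alpha_1}c_1+\cdots+\omega^{\alpha_n}c_n$ with $\alpha>\alpha_1>\cdots>\alpha_n$ and $0<c_i<\omega$. Each limit ordinal $\lambda$ has the fundamental sequence $(\lambda(x))_{x\in\mathbb N}$ defined by $(\gamma+\omega^{\beta+1})(x)=\gamma+\omega^\beta\cdot(x+1)$ and $(\gamma+\omega^{\lambda'})(x)=\gamma+\omega^{\lambda'(x)}$ for $\lambda'$ a limit. Fast-growing functions $F_\alpha:\mathbb N\to\mathbb N$: $F_0(x)=x+1$, $F_{\alpha+1}(x)=F_\alpha^{x+1}(x)$ (the $(x+1)$-fold iterate), $F_\lambda(x)=F_{\lambda(x)}(x)$. Ackermann functions $A_\alpha:\mathbb N\to\mathbb N$ for $\alpha>0$: $A_1(x)=2x$, $A_{\alpha+1}(x)=A_\alpha^{x}(1)$, $A_\lambda(x)=A_{\lambda(x)}(x)$. Extended Grzegorczyk class $\mathscr F_\alpha$: the smallest class of functions $\mathbb N^k\to\mathbb N$ ($k\ge 0$) containing the constant zero function, addition $(x_1,x_2)\mapsto x_1+x_2$,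 all projections, and $F_\alpha$, and closed under substitution (composition) and limited primitive recursion (if $h_0,h_1,g$ are in the class and $f(0,\vec x)=h_0(\vec x)$, $f(y+1,\vec x)=h_1(y,\vec x,f(y,\vec x))$, $f(y,\vec x)\le g(\max\{y,\vec x\})$, then $f$ is in the class). $\mathscr F_{<\alpha}=\bigcup_{\beta<\alpha}\mathscr F_\beta$; in the unions above $p$ ranges over unary functions. $\mathrm{DTime}(t(n))$ is the class of languages decided by a deterministic Turing machine in at most $t(n)$ steps on inputs of length $n$. -}

module Defs where

open import Data.Nat using (ℕ; zero; suc; _+_; _*_; _⊔_; _≤_)
open import Data.Fin using (Fin)
open import Data.Vec using (Vec; []; _∷_; _++_; lookup; tabulate; foldr)
open import Data.List using (List; []; _∷_; length; map)
open import Data.Maybe using (Maybe; just; nothing)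
open import Data.Bool using (Bool; true; false)
open import Data.Product using (Σ; _×_; _,_)
open import Data.Sum using (_⊎_)
open import Relation.Nullary using (¬_)
open import Relation.Binary.PropositionalEquality using (_≡_; _≢_)

-- A coefficient c is represented by
-- c consecutive equal exponents, so CNF terms are exactly the terms whose
-- exponents are (non-strictly) decreasing, hereditarily.

data OT : Set where
  𝟎    : OT
  ω^_+_ : OT → OT → OT

infixr 6 ω^_+_

-- strict order (correct on CNF terms)
data _<ₒ_ : OT → OT → Set where
  <𝟎  : ∀ {a b} → 𝟎 <ₒ (ω^ a + b)
  <hd : ∀ {a b c d} → a <ₒ c → (ω^ a + b) <ₒ (ω^ c + d)
  <tl : ∀ {a b d} → b <ₒ d → (ω^ a + b) <ₒ (ω^ a + d)

data HeadLe : OT → OT → Set where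
  hz : ∀ {a} → HeadLe 𝟎 a
  hs : ∀ {a c d} → (c <ₒ a ⊎ c ≡ a) → HeadLe (ω^ c + d) a

data CNF : OT → Set where
  cnf𝟎 : CNF 𝟎
  cnfω : ∀ {a b} → CNF a → CNF b → HeadLe b a → CNF (ω^ a + b)

𝟏 : OT
𝟏 = ω^ 𝟎 + 𝟎

data Kind : Set where
  zer  : Kind
  succ : OT → Kind
  limit : Kind

classify : OT → Kind
classify 𝟎 = zer
classify (ω^ 𝟎 + 𝟎) = succ 𝟎
classify (ω^ (ω^ c + d) + 𝟎) = limit
classify (ω^ a + (ω^ c + d)) with classify (ω^ c + d)
... | zer = zer            -- impossible case
... | succ β = succ (ω^ a + β)
... | limit = limit

ωmul : OT → ℕ → OT → OT
ωmul β zero t = t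
ωmul β (suc n) t = ω^ β + ωmul β n t

-- fundamental sequences (junk value 𝟎 on non-limits)
fund : OT → ℕ → OT
fund 𝟎 x = 𝟎
fund (ω^ a + 𝟎) x with classify a
... | zer = 𝟎
... | succ a' = ωmul a' (suc x) 𝟎
... | limit = ω^ (fund a x) + 𝟎
fund (ω^ a + (ω^ c + d)) x = ω^ a + fund (ω^ c + d) x

-- Fast-growing hierarchy, as graph relations:  FG α x y  ⇔  F_α(x) = y.

mutual
  data FG : OT → ℕ → ℕ → Set where
    F-zero : ∀ {x} → FG 𝟎 x (suc x)
    F-succ : ∀ {α β x y} → classify α ≡ succ β → FIter β (suc x) x y → FG α x y
    F-lim  : ∀ {α x y} → classify α ≡ limit → FG (fund α x) x y → FG α x y

  -- FIter β n x y  ⇔  F_β^n(x) = y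
  data FIter : OT → ℕ → ℕ → ℕ → Set where
    FI-zero : ∀ {β x} → FIter β zero x x
    FI-suc  : ∀ {β n x z y} → FIter β n x z → FG β z y → FIter β (suc n) x y

-- Ackermann hierarchy (α > 0):  AG α x y  ⇔  A_α(x) = y.
mutual
  data AG : OT → ℕ → ℕ → Set where
    A-one  : ∀ {x} → AG 𝟏 x (2 * x)
    A-succ : ∀ {α β x y} → classify α ≡ succ β → β ≢ 𝟎 → AIter β x 1 y → AG α x y
    A-lim  : ∀ {α x y} → classify α ≡ limit → AG (fund α x) x y → AG α x y

  data AIter : OT → ℕ → ℕ → ℕ → Set where
    AI-zero : ∀ {β x} → AIter β zero x x
    AI-suc  : ∀ {β n x z y} → AIter β n x z → AG β z y → AIter β (suc n) x y

-- Extended Grzegorczyk class 𝓕_α (functions ℕ^k → ℕ as Vec ℕ k → ℕ).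

maxV : ∀ {k} → Vec ℕ k → ℕ
maxV = foldr _ _⊔_ 0

data Grz (α : OT) : (k : ℕ) → (Vec ℕ k → ℕ) → Set where
  g-zero : ∀ {k} → Grz α k (λ _ → 0)
  g-add  : Grz α 2 (λ { (x ∷ y ∷ []) → x + y })
  g-proj : ∀ {k} (i : Fin k) → Grz α k (λ v → lookup v i)
  g-F    : (f : Vec ℕ 1 → ℕ) → (∀ x → FG α x (f (x ∷ []))) → Grz α 1 f
  g-subst : ∀ {k m} {f : Vec ℕ m → ℕ} {gs : Fin m → Vec ℕ k → ℕ} →
            Grz α m f → (∀ i → Grz α k (gs i)) →
            Grz α k (λ v → f (tabulate (λ i → gs i v)))
  g-lrec : ∀ {k} {h₀ : Vec ℕ k → ℕ} {h₁ : Vec ℕ (suc (k + 1)) → ℕ}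
             {g : Vec ℕ 1 → ℕ} (f : Vec ℕ (suc k) → ℕ) →
           Grz α k h₀ → Grz α (suc (k + 1)) h₁ → Grz α 1 g →
           (∀ v → f (0 ∷ v) ≡ h₀ v) →
           (∀ y v → f (suc y ∷ v) ≡ h₁ (y ∷ (v ++ (f (y ∷ v) ∷ [])))) →
           (∀ y v → f (y ∷ v) ≤ g ((y ⊔ maxV v) ∷ [])) →
           Grz α (suc k) f
  g-ext : ∀ {k} {f g : Vec ℕ k → ℕ} → Grz α k f → (∀ v → f v ≡ g v) → Grz α k g

GrzBelow : OT → (ℕ → ℕ) → Set
GrzBelow α p = Σ OT λ β → CNF β × β <ₒ α × Grz β 1 (λ { (x ∷ []) → p x })

-- Deterministic single-tape Turing machines over input alphabet Fin k.

data Move : Set where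
  left right stay : Move

record TM (k : ℕ) : Set where
  field
    Q     : ℕ
    G     : ℕ
    start : Fin Q
    blank : Fin G
    inp   : Fin k → Fin G
    δ     : Fin Q → Fin G → Bool ⊎ (Fin Q × Fin G × Move)
            -- inj₁ b : halt (accept if b = true); inj₂ : (new state, write, move)

record Config {k} (M : TM k) : Set where
  constructor conf
  open TM M
  field
    state : Fin Q
    lft   : List (Fin G)   -- cells to the left, nearest first
    hd    : Fin G
    rgt   : List (Fin G)   -- cells to the right, nearest first

module _ {k} (M : TM k) where
  open TM M

  moveHead : Move → List (Fin G) → Fin G → List (Fin G) → List (Fin G) × Fin G × List (Fin G)
  moveHead left [] h r = [] , blank , h ∷ r
  moveHead left (x ∷ l) h r = l , x , h ∷ r
  moveHead right l h [] = h ∷ l , blank , []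
  moveHead right l h (x ∷ r) = h ∷ l , x , r
  moveHead stay l h r = l , h , r

  step : Config M → Bool ⊎ Config M
  step (conf q l h r) with δ q h
  ... | _⊎_.inj₁ b = _⊎_.inj₁ b
  ... | _⊎_.inj₂ (q' , s , m) with moveHead m l s r
  ...   | (l' , h' , r') = _⊎_.inj₂ (conf q' l' h' r')

  -- run for at most n steps; just b = halted with answer b
  exec : ℕ → Config M → Maybe Bool
  exec zero c = nothing
  exec (suc n) c with step c
  ... | _⊎_.inj₁ b = just b
  ... | _⊎_.inj₂ c' = exec n c'

  initial : List (Fin k) → Config M
  initial [] = conf start [] blank []
  initial (a ∷ w) = conf start [] (inp a) (map inp w)

  DecidesWithin : (List (Fin k) → Set) → List (Fin k) → ℕ → Set
  DecidesWithin L w t =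
    (exec t (initial w) ≡ just true × L w) ⊎ (exec t (initial w) ≡ just false × ¬ L w)

-- L ∈ DTime(t(n)), with the time bound t given by its graph T (T n y ⇔ t(n) = y)
DTime : ∀ {k} → (ℕ → ℕ → Set) → (List (Fin k) → Set) → Set
DTime {k} T L = Σ (TM k) λ M → ∀ w → Σ ℕ λ y → T (length w) y × DecidesWithin M L w y

𝐀 : ∀ {k} → OT → (List (Fin k) → Set) → Set
𝐀 α L = Σ (ℕ → ℕ) λ p → GrzBelow α p × DTime (λ n y → AG α (p n) y) L

𝐅 : ∀ {k} → OT → (List (Fin k) → Set) → Set
𝐅 α L = Σ (ℕ → ℕ) λ p → GrzBelow α p × DTime (λ n y → FG α (p n) y) L

-- A_α and F_α are total, monotone in the argument and along the descent relation ⊑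
-- (predecessors and first members of fundamental sequences), and A_α ≤ F_α ≤ A_α ∘ h with
-- h x = 6x + 5; each of these is proved by induction along progressive predicates on ordinal
-- terms.  Hence a time bound A_α(p n) is also an F_α(p n) bound, while an F_α(q n) bound is an
-- A_α(p n) bound for p = 6 · F_β ∘ q, which lies in 𝓕_β whenever q does and dominates h ∘ q.

module Submission where

open import Defs
open import Data.Nat using (ℕ; zero; suc; _+_; _*_; _≤_; _<_; z≤n; s≤s; _≤′_; ≤′-refl; ≤′-step)
open import Data.Nat.Properties
open import Data.Nat.GeneralisedArithmetic using (fold; fold-+)
open import Data.Nat.Tactic.RingSolver using (solve-∀)
open import Data.Fin using (Fin)
open import Data.List using (List; length)
open import Data.Vec using (Vec; []; _∷_; head)
open import Data.Maybe using (just)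
open import Data.Product using (_×_; _,_; Σ; ∃; proj₁; proj₂)
open import Data.Sum using (inj₁; inj₂)
open import Data.Empty using (⊥-elim)
open import Relation.Binary.Core using (_Preserves_⟶_)
open import Relation.Binary.PropositionalEquality

infixr 5 _⊕_
_⊕_ : OT → OT → OT
𝟎 ⊕ t = t
(ω^ a + b) ⊕ t = ω^ a + (b ⊕ t)

⊕-identityʳ : ∀ γ → γ ⊕ 𝟎 ≡ γ
⊕-identityʳ 𝟎 = refl
⊕-identityʳ (ω^ a + b) = cong (ω^ a +_) (⊕-identityʳ b)

⊕-assoc : ∀ a b c → (a ⊕ b) ⊕ c ≡ a ⊕ (b ⊕ c)
⊕-assoc 𝟎 b c = refl
⊕-assoc (ω^ a + b) c d = cong (ω^ a +_) (⊕-assoc b c d)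

classify-cons-succ : ∀ a s {β} → classify s ≡ succ β → classify (ω^ a + s) ≡ succ (ω^ a + β)
classify-cons-succ a 𝟎 ()
classify-cons-succ 𝟎 (ω^ c + d) eq with classify (ω^ c + d) | eq
... | _ | refl = refl
classify-cons-succ (ω^ _ + _) (ω^ c + d) eq with classify (ω^ c + d) | eq
... | _ | refl = refl

classify-cons-limit : ∀ a s → classify s ≡ limit → classify (ω^ a + s) ≡ limit
classify-cons-limit a 𝟎 ()
classify-cons-limit 𝟎 (ω^ c + d) eq with classify (ω^ c + d) | eq
... | _ | refl = refl
classify-cons-limit (ω^ _ + _) (ω^ c + d) eq with classify (ω^ c + d) | eq
... | _ | refl = refl

classify-cons-limit⁻¹ : ∀ a c d → classify (ω^ a + (ω^ c + d)) ≡ limit → classify (ω^ c + d) ≡ limit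
classify-cons-limit⁻¹ 𝟎 c d eq with classify (ω^ c + d) | eq
... | limit | _ = refl
classify-cons-limit⁻¹ (ω^ _ + _) c d eq with classify (ω^ c + d) | eq
... | limit | _ = refl

classify-cons≢zer : ∀ a b → classify (ω^ a + b) ≢ zer
classify-cons≢zer 𝟎 𝟎 ()
classify-cons≢zer (ω^ c + d) 𝟎 ()
classify-cons≢zer 𝟎 (ω^ c + d) eq with classify (ω^ c + d) | classify-cons≢zer c d | eq
... | zer | ≢zer | _ = ≢zer refl
classify-cons≢zer (ω^ _ + _) (ω^ c + d) eq with classify (ω^ c + d) | classify-cons≢zer c d | eq
... | zer | ≢zer | _ = ≢zer refl

classify≡succ𝟎⇒≡𝟏 : ∀ α → classify α ≡ succ 𝟎 → α ≡ 𝟏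
classify≡succ𝟎⇒≡𝟏 𝟎 ()
classify≡succ𝟎⇒≡𝟏 (ω^ 𝟎 + 𝟎) eq = refl
classify≡succ𝟎⇒≡𝟏 (ω^ (ω^ _ + _) + 𝟎) ()
classify≡succ𝟎⇒≡𝟏 (ω^ 𝟎 + (ω^ c + d)) eq with classify (ω^ c + d) | eq
... | zer | ()
... | limit | ()
classify≡succ𝟎⇒≡𝟏 (ω^ (ω^ _ + _) + (ω^ c + d)) eq with classify (ω^ c + d) | eq
... | zer | ()
... | limit | ()

fund-cons : ∀ a s x → classify s ≡ limit → fund (ω^ a + s) x ≡ ω^ a + fund s x
fund-cons a 𝟎 x ()
fund-cons 𝟎 (ω^ c + d) x eq = refl
fund-cons (ω^ _ + _) (ω^ c + d) x eq = refl

fund-ω^-succ : ∀ a {b} x → classify a ≡ succ b → fund (ω^ a + 𝟎) x ≡ ωmul b (suc x) 𝟎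
fund-ω^-succ a x eq with classify a | eq
... | _ | refl = refl

fund-ω^-limit : ∀ a x → classify a ≡ limit → fund (ω^ a + 𝟎) x ≡ ω^ (fund a x) + 𝟎
fund-ω^-limit a x eq with classify a | eq
... | _ | refl = refl

fund≢𝟎 : ∀ α x → classify α ≡ limit → fund α x ≢ 𝟎
fund≢𝟎 𝟎 x ()
fund≢𝟎 (ω^ 𝟎 + 𝟎) x ()
fund≢𝟎 (ω^ (ω^ c + d) + 𝟎) x _ with classify (ω^ c + d) | classify-cons≢zer c d
... | zer | ≢zer = ⊥-elim (≢zer refl)
... | succ _ | _ = λ ()
... | limit | _ = λ ()
fund≢𝟎 (ω^ a + (ω^ c + d)) x _ = λ ()

classify-⊕-succ : ∀ δ t {β} → classify t ≡ succ β → classify (δ ⊕ t) ≡ succ (δ ⊕ β)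
classify-⊕-succ 𝟎 t eq = eq
classify-⊕-succ (ω^ a + b) t eq = classify-cons-succ a (b ⊕ t) (classify-⊕-succ b t eq)

classify-⊕-limit : ∀ δ t → classify t ≡ limit → classify (δ ⊕ t) ≡ limit
classify-⊕-limit 𝟎 t eq = eq
classify-⊕-limit (ω^ a + b) t eq = classify-cons-limit a (b ⊕ t) (classify-⊕-limit b t eq)

fund-⊕ : ∀ δ t x → classify t ≡ limit → fund (δ ⊕ t) x ≡ δ ⊕ fund t x
fund-⊕ 𝟎 t x eq = refl
fund-⊕ (ω^ a + b) t x eq =
  trans (fund-cons a (b ⊕ t) x (classify-⊕-limit b t eq)) (cong (ω^ a +_) (fund-⊕ b t x eq))

ωmul-snoc : ∀ b n → ωmul b (suc n) 𝟎 ≡ ωmul b n 𝟎 ⊕ (ω^ b + 𝟎)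
ωmul-snoc b zero = refl
ωmul-snoc b (suc n) = cong (ω^ b +_) (ωmul-snoc b n)

-- Progressive induction

record Progressive (X : OT → Set) : Set where
  field
    at-zero  : X 𝟎
    at-succ  : ∀ {α β} → classify α ≡ succ β → X β → X α
    at-limit : ∀ {α} → classify α ≡ limit → (∀ x → X (fund α x)) → X α
open Progressive

-- Gentzen's jump: Jump X is progressive whenever X is, so structural recursion on the
-- exponent c carries X from γ to γ ⊕ ω^c, and hence along every term.
Jump : (OT → Set) → OT → Set
Jump X a = ∀ γ → X γ → X (γ ⊕ (ω^ a + 𝟎))

module _ {X : OT → Set} (P : Progressive X) where

  private
    X-⊕-limit : ∀ γ {a} → classify (ω^ a + 𝟎) ≡ limit →
                (∀ x → X (γ ⊕ fund (ω^ a + 𝟎) x)) → X (γ ⊕ (ω^ a + 𝟎))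
    X-⊕-limit γ {a} lim h = at-limit P (classify-⊕-limit γ _ lim)
      λ x → subst X (sym (fund-⊕ γ (ω^ a + 𝟎) x lim)) (h x)

  Jump-ωmul : ∀ {b} → Jump X b → ∀ n γ → X γ → X (γ ⊕ ωmul b n 𝟎)
  Jump-ωmul jb zero γ h = subst X (sym (⊕-identityʳ γ)) h
  Jump-ωmul {b} jb (suc n) γ h =
    subst X (⊕-assoc γ (ω^ b + 𝟎) (ωmul b n 𝟎)) (Jump-ωmul jb n (γ ⊕ (ω^ b + 𝟎)) (jb γ h))

  Jump-progressive : Progressive (Jump X)
  at-zero Jump-progressive γ h = at-succ P (classify-⊕-succ γ (ω^ 𝟎 + 𝟎) refl) (subst X (sym (⊕-identityʳ γ)) h)
  at-succ Jump-progressive {𝟎} ()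
  at-succ Jump-progressive {ω^ c + d} eq jb γ h = X-⊕-limit γ refl λ x →
    subst (λ t → X (γ ⊕ t)) (sym (fund-ω^-succ (ω^ c + d) x eq)) (Jump-ωmul jb (suc x) γ h)
  at-limit Jump-progressive {𝟎} ()
  at-limit Jump-progressive {ω^ c + d} eq jf γ h = X-⊕-limit γ refl λ x →
    subst (λ t → X (γ ⊕ t)) (sym (fund-ω^-limit (ω^ c + d) x eq)) (jf x γ h)

progressive-⊕ : ∀ {X} → Progressive X → ∀ t γ → X γ → X (γ ⊕ t)
progressive-⊕ {X} P 𝟎 γ h = subst X (sym (⊕-identityʳ γ)) h
progressive-⊕ {X} P (ω^ c + d) γ h = subst X (⊕-assoc γ (ω^ c + 𝟎) d)
  (progressive-⊕ P d (γ ⊕ (ω^ c + 𝟎)) (progressive-⊕ JP c 𝟎 (at-zero JP) γ h))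
  where JP = Jump-progressive P

progressive-induction : ∀ {X} → Progressive X → ∀ α → X α
progressive-induction P α = progressive-⊕ P α 𝟎 (at-zero P)

-- Descent along predecessors and first members of fundamental sequences

infix 4 _⊑_
data _⊑_ : OT → OT → Set where
  ⊑-refl : ∀ {β} → β ⊑ β
  ⊑-pred : ∀ {β α α'} → classify α ≡ succ α' → β ⊑ α' → β ⊑ α
  ⊑-fund : ∀ {β α} → classify α ≡ limit → β ⊑ fund α 0 → β ⊑ α

⊑-trans : ∀ {β γ α} → β ⊑ γ → γ ⊑ α → β ⊑ α
⊑-trans β⊑γ ⊑-refl = β⊑γ
⊑-trans β⊑γ (⊑-pred eq γ⊑α') = ⊑-pred eq (⊑-trans β⊑γ γ⊑α')
⊑-trans β⊑γ (⊑-fund eq γ⊑α₀) = ⊑-fund eq (⊑-trans β⊑γ γ⊑α₀)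

⊑𝟎⇒≡𝟎 : ∀ {β} → β ⊑ 𝟎 → β ≡ 𝟎
⊑𝟎⇒≡𝟎 ⊑-refl = refl

⊑-ω^ : ∀ {u v} → u ⊑ v → (ω^ u + 𝟎) ⊑ (ω^ v + 𝟎)
⊑-ω^ ⊑-refl = ⊑-refl
⊑-ω^ {v = ω^ c + d} (⊑-pred eq u⊑v') =
  ⊑-fund refl (subst (_ ⊑_) (sym (fund-ω^-succ (ω^ c + d) 0 eq)) (⊑-ω^ u⊑v'))
⊑-ω^ {v = ω^ c + d} (⊑-fund eq u⊑v₀) =
  ⊑-fund refl (subst (_ ⊑_) (sym (fund-ω^-limit (ω^ c + d) 0 eq)) (⊑-ω^ u⊑v₀))

⊑-cons : ∀ a {u v} → u ⊑ v → (ω^ a + u) ⊑ (ω^ a + v)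
⊑-cons a ⊑-refl = ⊑-refl
⊑-cons a {v = v} (⊑-pred eq u⊑v') = ⊑-pred (classify-cons-succ a v eq) (⊑-cons a u⊑v')
⊑-cons a {v = v} (⊑-fund eq u⊑v₀) =
  ⊑-fund (classify-cons-limit a v eq) (subst (_ ⊑_) (sym (fund-cons a v 0 eq)) (⊑-cons a u⊑v₀))

⊑-⊕-ω^ : ∀ b δ → δ ⊑ δ ⊕ (ω^ b + 𝟎)
⊑-⊕-ω^ = progressive-induction P
  where
  via-fund : ∀ {δ a} → classify (ω^ a + 𝟎) ≡ limit →
             δ ⊑ δ ⊕ fund (ω^ a + 𝟎) 0 → δ ⊑ δ ⊕ (ω^ a + 𝟎)
  via-fund {δ} lim h = ⊑-fund (classify-⊕-limit δ _ lim) (subst (δ ⊑_) (sym (fund-⊕ δ _ 0 lim)) h)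
  P : Progressive (λ b → ∀ δ → δ ⊑ δ ⊕ (ω^ b + 𝟎))
  at-zero P δ = ⊑-pred (classify-⊕-succ δ (ω^ 𝟎 + 𝟎) refl) (subst (δ ⊑_) (sym (⊕-identityʳ δ)) ⊑-refl)
  at-succ P {ω^ c + d} eq IH δ =
    via-fund refl (subst (λ t → δ ⊑ δ ⊕ t) (sym (fund-ω^-succ (ω^ c + d) 0 eq)) (IH δ))
  at-limit P {ω^ c + d} eq IH δ =
    via-fund refl (subst (λ t → δ ⊑ δ ⊕ t) (sym (fund-ω^-limit (ω^ c + d) 0 eq)) (IH 0 δ))

fund-⊑-fund-suc : ∀ λ' x → classify λ' ≡ limit → fund λ' x ⊑ fund λ' (suc x)
fund-⊑-fund-suc (ω^ a + 𝟎) x _ with classify a in eq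
... | zer = ⊑-refl
... | succ a' = subst (ωmul a' (suc x) 𝟎 ⊑_) (sym (ωmul-snoc a' (suc x))) (⊑-⊕-ω^ a' (ωmul a' (suc x) 𝟎))
... | limit = ⊑-ω^ (fund-⊑-fund-suc a x eq)
fund-⊑-fund-suc (ω^ a + (ω^ c + d)) x lim =
  ⊑-cons a (fund-⊑-fund-suc (ω^ c + d) x (classify-cons-limit⁻¹ a c d lim))

-- The Bachmann property; it lets monotonicity in the argument survive limit steps.
fund-⊑-mono : ∀ λ' {x y} → classify λ' ≡ limit → x ≤ y → fund λ' x ⊑ fund λ' y
fund-⊑-mono λ' lim x≤y = go (≤⇒≤′ x≤y)
  where
  go : ∀ {x y} → x ≤′ y → fund λ' x ⊑ fund λ' y
  go ≤′-refl = ⊑-refl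
  go (≤′-step {n} x≤′n) = ⊑-trans (go x≤′n) (fund-⊑-fund-suc λ' n lim)

-- Iteration of functions on ℕ, fold x f n = fⁿ(x)

fold-sucʳ : ∀ (f : ℕ → ℕ) x n → fold x f (suc n) ≡ fold (f x) f n
fold-sucʳ f x n = trans (cong (fold x f) (+-comm 1 n)) (fold-+ x f n)

fold-inflationary : ∀ {f : ℕ → ℕ} → (∀ x → x ≤ f x) → ∀ n x → x ≤ fold x f n
fold-inflationary infl zero x = ≤-refl
fold-inflationary infl (suc n) x = ≤-trans (fold-inflationary infl n x) (infl _)

fold-mono : ∀ {f : ℕ → ℕ} → (∀ x → x ≤ f x) → f Preserves _≤_ ⟶ _≤_ →
            ∀ {m n x y} → m ≤ n → x ≤ y → fold x f m ≤ fold y f n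
fold-mono infl mono {n = n} z≤n x≤y = ≤-trans x≤y (fold-inflationary infl n _)
fold-mono infl mono (s≤s m≤n) x≤y = mono (fold-mono infl mono m≤n x≤y)

fold-pointwise : ∀ {f g : ℕ → ℕ} → (∀ x → g x ≤ f x) → f Preserves _≤_ ⟶ _≤_ →
                 ∀ n {x y} → x ≤ y → fold x g n ≤ fold y f n
fold-pointwise g≤f mono zero x≤y = x≤y
fold-pointwise g≤f mono (suc n) x≤y = ≤-trans (g≤f _) (mono (fold-pointwise g≤f mono n x≤y))

fold-simulation : ∀ {f g : ℕ → ℕ} k → (∀ x → x ≤ f x) →
                  (∀ {y z} → y ≤ z → 1 ≤ z → g y ≤ fold z f k) →
                  ∀ n {y z} → y ≤ z → 1 ≤ z → fold y g n ≤ fold z f (n * k)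
fold-simulation k infl step zero y≤z 1≤z = y≤z
fold-simulation {f} {g} k infl step (suc n) {y} {z} y≤z 1≤z = begin
  g (fold y g n)               ≤⟨ step (fold-simulation k infl step n y≤z 1≤z)
                                       (≤-trans 1≤z (fold-inflationary infl (n * k) z)) ⟩
  fold (fold z f (n * k)) f k  ≡⟨ fold-+ z f k ⟨
  fold z f (k + n * k)         ∎
  where open ≤-Reasoning

doubling⇒inflationary : ∀ {f : ℕ → ℕ} → (∀ x → 2 * x ≤ f x) → ∀ x → x ≤ f x
doubling⇒inflationary dbl x = ≤-trans (m≤m+n x (x + 0)) (dbl x)

fold-doubling-suc : ∀ {f : ℕ → ℕ} → (∀ x → 2 * x ≤ f x) → ∀ n → suc n ≤ fold 1 f n
fold-doubling-suc dbl zero = ≤-refl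
fold-doubling-suc {f} dbl (suc n) = begin
  suc (suc n)         ≤⟨ m≤m+n (suc (suc n)) n ⟩
  suc (suc n) + n     ≡⟨ twice-suc n ⟨
  2 * suc n           ≤⟨ *-monoʳ-≤ 2 (fold-doubling-suc dbl n) ⟩
  2 * fold 1 f n      ≤⟨ dbl _ ⟩
  f (fold 1 f n)      ∎
  where
  open ≤-Reasoning
  twice-suc : ∀ n → 2 * suc n ≡ suc (suc n) + n
  twice-suc = solve-∀

fold-doubling : ∀ {f : ℕ → ℕ} → (∀ x → 2 * x ≤ f x) → ∀ n → 2 * n ≤ fold 1 f n
fold-doubling dbl zero = z≤n
fold-doubling dbl (suc n) = ≤-trans (*-monoʳ-≤ 2 (fold-doubling-suc dbl n)) (dbl _)

FIter-total : ∀ {β} → (∀ x → ∃ (FG β x)) → ∀ n x → ∃ (FIter β n x)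
FIter-total Fβ zero x = x , FI-zero
FIter-total Fβ (suc n) x with FIter-total Fβ n x
... | z , it with Fβ z
... | y , fg = y , FI-suc it fg

FG-total : ∀ α x → ∃ (FG α x)
FG-total = progressive-induction P
  where
  P : Progressive (λ α → ∀ x → ∃ (FG α x))
  at-zero P x = suc x , F-zero
  at-succ P e IH x with FIter-total IH (suc x) x
  ... | y , it = y , F-succ e it
  at-limit P e IH x with IH x x
  ... | y , fg = y , F-lim e fg

mutual
  FG-functional : ∀ {α x y y'} → FG α x y → FG α x y' → y ≡ y'
  FG-functional F-zero F-zero = refl
  FG-functional (F-succ e it) (F-succ e' it') with trans (sym e) e'
  ... | refl = FIter-functional it it'
  FG-functional (F-succ e _) (F-lim e' _) with trans (sym e) e'
  ... | ()
  FG-functional (F-lim e _) (F-succ e' _) with trans (sym e) e'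
  ... | ()
  FG-functional (F-lim _ fg) (F-lim _ fg') = FG-functional fg fg'

  FIter-functional : ∀ {β n x y y'} → FIter β n x y → FIter β n x y' → y ≡ y'
  FIter-functional FI-zero FI-zero = refl
  FIter-functional (FI-suc it fg) (FI-suc it' fg') with FIter-functional it it'
  ... | refl = FG-functional fg fg'

F : OT → ℕ → ℕ
F α x = proj₁ (FG-total α x)

FG-F : ∀ α x → FG α x (F α x)
FG-F α x = proj₂ (FG-total α x)

FG⇒≡F : ∀ α x {y} → FG α x y → y ≡ F α x
FG⇒≡F α x fg = FG-functional fg (FG-F α x)

FIter-fold : ∀ β n x → FIter β n x (fold x (F β) n)
FIter-fold β zero x = FI-zero
FIter-fold β (suc n) x = FI-suc (FIter-fold β n x) (FG-F β _)

FIter-𝟎 : ∀ n x → FIter 𝟎 n x (n + x)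
FIter-𝟎 zero x = FI-zero
FIter-𝟎 (suc n) x = FI-suc (FIter-𝟎 n x) F-zero

F-at-𝟎 : ∀ x → F 𝟎 x ≡ suc x
F-at-𝟎 x = sym (FG⇒≡F 𝟎 x F-zero)

F-at-𝟏 : ∀ x → F 𝟏 x ≡ suc x + x
F-at-𝟏 x = sym (FG⇒≡F 𝟏 x (F-succ refl (FIter-𝟎 (suc x) x)))

F-at-succ : ∀ α {β} → classify α ≡ succ β → ∀ x → F α x ≡ fold x (F β) (suc x)
F-at-succ α {β} e x = sym (FG⇒≡F α x (F-succ e (FIter-fold β (suc x) x)))

F-at-limit : ∀ α → classify α ≡ limit → ∀ x → F α x ≡ F (fund α x) x
F-at-limit α e x = sym (FG⇒≡F α x (F-lim e (FG-F _ x)))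

record F-Growth (α : OT) : Set where
  field
    F-inflationary : ∀ x → x < F α x
    F-monotone     : ∀ {β x y} → β ⊑ α → x ≤ y → F β x ≤ F α y
open F-Growth

F-growth-𝟎 : F-Growth 𝟎
F-growth-𝟎 = record { F-inflationary = λ x → ≤-reflexive (sym (F-at-𝟎 x)) ; F-monotone = mono }
  where
  mono : ∀ {β x y} → β ⊑ 𝟎 → x ≤ y → F β x ≤ F 𝟎 y
  mono {x = x} {y} ⊑-refl x≤y = subst₂ _≤_ (sym (F-at-𝟎 x)) (sym (F-at-𝟎 y)) (s≤s x≤y)

F-growth-succ : ∀ {α β} → classify α ≡ succ β → F-Growth β → F-Growth α
F-growth-succ {α} {β} e IH = record { F-inflationary = infl ; F-monotone = mono }
  where
  open ≤-Reasoning
  Fβ-inflationary : ∀ x → x ≤ F β x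
  Fβ-inflationary x = <⇒≤ (F-inflationary IH x)
  Fβ-monotone : F β Preserves _≤_ ⟶ _≤_
  Fβ-monotone = F-monotone IH ⊑-refl
  infl : ∀ x → x < F α x
  infl x = begin-strict
    x                     ≤⟨ fold-inflationary Fβ-inflationary x x ⟩
    fold x (F β) x        <⟨ F-inflationary IH _ ⟩
    F β (fold x (F β) x)  ≡⟨ F-at-succ α e x ⟨
    F α x                 ∎
  Fβ≤Fα : ∀ y → F β y ≤ F α y
  Fβ≤Fα y = begin
    F β y                 ≤⟨ Fβ-monotone (fold-inflationary Fβ-inflationary y y) ⟩
    F β (fold y (F β) y)  ≡⟨ F-at-succ α e y ⟨
    F α y                 ∎
  mono : ∀ {γ x y} → γ ⊑ α → x ≤ y → F γ x ≤ F α y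
  mono {x = x} {y} ⊑-refl x≤y = begin
    F α x                 ≡⟨ F-at-succ α e x ⟩
    fold x (F β) (suc x)  ≤⟨ fold-mono Fβ-inflationary Fβ-monotone (s≤s x≤y) x≤y ⟩
    fold y (F β) (suc y)  ≡⟨ F-at-succ α e y ⟨
    F α y                 ∎
  mono (⊑-pred e' γ⊑β) x≤y with trans (sym e') e
  ... | refl = ≤-trans (F-monotone IH γ⊑β x≤y) (Fβ≤Fα _)
  mono (⊑-fund e' _) _ with trans (sym e') e
  ... | ()

F-growth-limit : ∀ {α} → classify α ≡ limit → (∀ x → F-Growth (fund α x)) → F-Growth α
F-growth-limit {α} e IH = record { F-inflationary = infl ; F-monotone = mono }
  where
  open ≤-Reasoning
  infl : ∀ x → x < F α x
  infl x = subst (x <_) (sym (F-at-limit α e x)) (F-inflationary (IH x) x)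
  mono : ∀ {γ x y} → γ ⊑ α → x ≤ y → F γ x ≤ F α y
  mono {x = x} {y} ⊑-refl x≤y = begin
    F α x           ≡⟨ F-at-limit α e x ⟩
    F (fund α x) x  ≤⟨ F-monotone (IH y) (fund-⊑-mono α e x≤y) x≤y ⟩
    F (fund α y) y  ≡⟨ F-at-limit α e y ⟨
    F α y           ∎
  mono (⊑-pred e' _) _ with trans (sym e') e
  ... | ()
  mono {γ} {x} {y} (⊑-fund _ γ⊑α₀) x≤y = begin
    F γ x           ≤⟨ F-monotone (IH y) (⊑-trans γ⊑α₀ (fund-⊑-mono α e z≤n)) x≤y ⟩
    F (fund α y) y  ≡⟨ F-at-limit α e y ⟨
    F α y           ∎

F-growth : ∀ α → F-Growth α
F-growth = progressive-induction record
  { at-zero = F-growth-𝟎 ; at-succ = F-growth-succ ; at-limit = F-growth-limit }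

AIter-total : ∀ {β} → (∀ x → ∃ (AG β x)) → ∀ n x → ∃ (AIter β n x)
AIter-total Aβ zero x = x , AI-zero
AIter-total Aβ (suc n) x with AIter-total Aβ n x
... | z , it with Aβ z
... | y , ag = y , AI-suc it ag

AG-total : ∀ α → α ≢ 𝟎 → ∀ x → ∃ (AG α x)
AG-total = progressive-induction P
  where
  P : Progressive (λ α → α ≢ 𝟎 → ∀ x → ∃ (AG α x))
  at-zero P 𝟎≢𝟎 = ⊥-elim (𝟎≢𝟎 refl)
  at-succ P {α} {𝟎} e _ _ x with classify≡succ𝟎⇒≡𝟏 α e
  ... | refl = 2 * x , A-one
  at-succ P {β = ω^ _ + _} e IH _ x with AIter-total (IH (λ ())) x 1
  ... | y , it = y , A-succ e (λ ()) it
  at-limit P {α} e IH _ x with IH x (fund≢𝟎 α x e) x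
  ... | y , ag = y , A-lim e ag

mutual
  AG-functional : ∀ {α x y y'} → AG α x y → AG α x y' → y ≡ y'
  AG-functional A-one A-one = refl
  AG-functional A-one (A-succ refl 𝟎≢𝟎 _) = ⊥-elim (𝟎≢𝟎 refl)
  AG-functional (A-succ refl 𝟎≢𝟎 _) A-one = ⊥-elim (𝟎≢𝟎 refl)
  AG-functional (A-succ e _ it) (A-succ e' _ it') with trans (sym e) e'
  ... | refl = AIter-functional it it'
  AG-functional (A-succ e _ _) (A-lim e' _) with trans (sym e) e'
  ... | ()
  AG-functional (A-lim e _) (A-succ e' _ _) with trans (sym e) e'
  ... | ()
  AG-functional (A-lim _ ag) (A-lim _ ag') = AG-functional ag ag'

  AIter-functional : ∀ {β n x y y'} → AIter β n x y → AIter β n x y' → y ≡ y'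
  AIter-functional AI-zero AI-zero = refl
  AIter-functional (AI-suc it ag) (AI-suc it' ag') with AIter-functional it it'
  ... | refl = AG-functional ag ag'

-- junk value at 𝟎, where the Ackermann hierarchy is undefined
A : OT → ℕ → ℕ
A 𝟎 _ = 0
A α@(ω^ _ + _) x = proj₁ (AG-total α (λ ()) x)

AG-A : ∀ {α} → α ≢ 𝟎 → ∀ x → AG α x (A α x)
AG-A {𝟎} 𝟎≢𝟎 = ⊥-elim (𝟎≢𝟎 refl)
AG-A {ω^ _ + _} _ x = proj₂ (AG-total _ (λ ()) x)

AG⇒≢𝟎 : ∀ {α x y} → AG α x y → α ≢ 𝟎
AG⇒≢𝟎 A-one ()
AG⇒≢𝟎 (A-succ () _ _) refl
AG⇒≢𝟎 (A-lim () _) refl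

AG⇒≡A : ∀ α x {y} → AG α x y → y ≡ A α x
AG⇒≡A α x ag = AG-functional ag (AG-A (AG⇒≢𝟎 ag) x)

AIter-fold : ∀ {β} → β ≢ 𝟎 → ∀ n x → AIter β n x (fold x (A β) n)
AIter-fold β≢𝟎 zero x = AI-zero
AIter-fold β≢𝟎 (suc n) x = AI-suc (AIter-fold β≢𝟎 n x) (AG-A β≢𝟎 _)

A-at-𝟏 : ∀ x → A 𝟏 x ≡ 2 * x
A-at-𝟏 x = sym (AG⇒≡A 𝟏 x A-one)

A-at-succ : ∀ α {β} → classify α ≡ succ β → β ≢ 𝟎 → ∀ x → A α x ≡ fold 1 (A β) x
A-at-succ α e β≢𝟎 x = sym (AG⇒≡A α x (A-succ e β≢𝟎 (AIter-fold β≢𝟎 x 1)))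

A-at-limit : ∀ α → classify α ≡ limit → ∀ x → A α x ≡ A (fund α x) x
A-at-limit α e x = sym (AG⇒≡A α x (A-lim e (AG-A (fund≢𝟎 α x e) x)))

record A-Growth (α : OT) : Set where
  field
    A-doubling : ∀ x → 2 * x ≤ A α x
    A-at-0≤1   : A α 0 ≤ 1
    A-monotone : ∀ {β x y} → β ≢ 𝟎 → β ⊑ α → x ≤ y → A β x ≤ A α y
open A-Growth

A-growth-𝟏 : A-Growth 𝟏
A-growth-𝟏 = record
  { A-doubling = λ x → ≤-reflexive (sym (A-at-𝟏 x))
  ; A-at-0≤1   = ≤-trans (≤-reflexive (A-at-𝟏 0)) z≤n
  ; A-monotone = mono
  }
  where
  mono : ∀ {β x y} → β ≢ 𝟎 → β ⊑ 𝟏 → x ≤ y → A β x ≤ A 𝟏 y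
  mono {x = x} {y} _ ⊑-refl x≤y = subst₂ _≤_ (sym (A-at-𝟏 x)) (sym (A-at-𝟏 y)) (*-monoʳ-≤ 2 x≤y)
  mono β≢𝟎 (⊑-pred refl β⊑𝟎) _ = ⊥-elim (β≢𝟎 (⊑𝟎⇒≡𝟎 β⊑𝟎))

A-growth-succ : ∀ {α β} → classify α ≡ succ β → β ≢ 𝟎 → A-Growth β → A-Growth α
A-growth-succ {α} {β} e β≢𝟎 IH = record
  { A-doubling = λ x → subst (2 * x ≤_) (sym (A-at-succ α e β≢𝟎 x)) (fold-doubling (A-doubling IH) x)
  ; A-at-0≤1   = ≤-reflexive (A-at-succ α e β≢𝟎 0)
  ; A-monotone = mono
  }
  where
  open ≤-Reasoning
  Aβ-monotone : A β Preserves _≤_ ⟶ _≤_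
  Aβ-monotone = A-monotone IH β≢𝟎 ⊑-refl
  Aβ≤Aα : ∀ y → A β y ≤ A α y
  Aβ≤Aα zero = subst (A β 0 ≤_) (sym (A-at-succ α e β≢𝟎 0)) (A-at-0≤1 IH)
  Aβ≤Aα (suc n) = begin
    A β (suc n)           ≤⟨ Aβ-monotone (fold-doubling-suc (A-doubling IH) n) ⟩
    A β (fold 1 (A β) n)  ≡⟨ A-at-succ α e β≢𝟎 (suc n) ⟨
    A α (suc n)           ∎
  mono : ∀ {γ x y} → γ ≢ 𝟎 → γ ⊑ α → x ≤ y → A γ x ≤ A α y
  mono {x = x} {y} _ ⊑-refl x≤y = begin
    A α x           ≡⟨ A-at-succ α e β≢𝟎 x ⟩
    fold 1 (A β) x  ≤⟨ fold-mono (doubling⇒inflationary (A-doubling IH)) Aβ-monotone x≤y ≤-refl ⟩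
    fold 1 (A β) y  ≡⟨ A-at-succ α e β≢𝟎 y ⟨
    A α y           ∎
  mono γ≢𝟎 (⊑-pred e' γ⊑β) x≤y with trans (sym e') e
  ... | refl = ≤-trans (A-monotone IH γ≢𝟎 γ⊑β x≤y) (Aβ≤Aα _)
  mono _ (⊑-fund e' _) _ with trans (sym e') e
  ... | ()

A-growth-limit : ∀ {α} → classify α ≡ limit → (∀ x → A-Growth (fund α x)) → A-Growth α
A-growth-limit {α} e IH = record
  { A-doubling = λ x → subst (2 * x ≤_) (sym (A-at-limit α e x)) (A-doubling (IH x) x)
  ; A-at-0≤1   = subst (_≤ 1) (sym (A-at-limit α e 0)) (A-at-0≤1 (IH 0))
  ; A-monotone = mono
  }
  where
  open ≤-Reasoning
  mono : ∀ {γ x y} → γ ≢ 𝟎 → γ ⊑ α → x ≤ y → A γ x ≤ A α y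
  mono {x = x} {y} _ ⊑-refl x≤y = begin
    A α x           ≡⟨ A-at-limit α e x ⟩
    A (fund α x) x  ≤⟨ A-monotone (IH y) (fund≢𝟎 α x e) (fund-⊑-mono α e x≤y) x≤y ⟩
    A (fund α y) y  ≡⟨ A-at-limit α e y ⟨
    A α y           ∎
  mono _ (⊑-pred e' _) _ with trans (sym e') e
  ... | ()
  mono {γ} {x} {y} γ≢𝟎 (⊑-fund _ γ⊑α₀) x≤y = begin
    A γ x           ≤⟨ A-monotone (IH y) γ≢𝟎 (⊑-trans γ⊑α₀ (fund-⊑-mono α e z≤n)) x≤y ⟩
    A (fund α y) y  ≡⟨ A-at-limit α e y ⟨
    A α y           ∎

A-growth : ∀ α → α ≢ 𝟎 → A-Growth α
A-growth = progressive-induction P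
  where
  P : Progressive (λ α → α ≢ 𝟎 → A-Growth α)
  at-zero P 𝟎≢𝟎 = ⊥-elim (𝟎≢𝟎 refl)
  at-succ P {α} {𝟎} e _ _ with classify≡succ𝟎⇒≡𝟏 α e
  ... | refl = A-growth-𝟏
  at-succ P {β = ω^ _ + _} e IH _ = A-growth-succ e (λ ()) (IH (λ ()))
  at-limit P {α} e IH _ = A-growth-limit e λ x → IH x (fund≢𝟎 α x e)

A≤F : ∀ α → α ≢ 𝟎 → ∀ x → A α x ≤ F α x
A≤F = progressive-induction P
  where
  open ≤-Reasoning
  P : Progressive (λ α → α ≢ 𝟎 → ∀ x → A α x ≤ F α x)
  at-zero P 𝟎≢𝟎 = ⊥-elim (𝟎≢𝟎 refl)
  at-succ P {α} {𝟎} e _ _ x with classify≡succ𝟎⇒≡𝟏 α e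
  ... | refl = begin
    A 𝟏 x        ≡⟨ A-at-𝟏 x ⟩
    x + (x + 0)  ≡⟨ cong (x +_) (+-identityʳ x) ⟩
    x + x        ≤⟨ n≤1+n (x + x) ⟩
    suc x + x    ≡⟨ F-at-𝟏 x ⟨
    F 𝟏 x        ∎
  at-succ P {α} {β@(ω^ _ + _)} e IH _ x = begin
    A α x                 ≡⟨ A-at-succ α e (λ ()) x ⟩
    fold 1 (A β) x        ≤⟨ fold-pointwise (IH (λ ())) (F-monotone (F-growth β) ⊑-refl) x
                               (≤-trans (s≤s z≤n) (F-inflationary (F-growth β) x)) ⟩
    fold (F β x) (F β) x  ≡⟨ fold-sucʳ (F β) x x ⟨
    fold x (F β) (suc x)  ≡⟨ F-at-succ α e x ⟨
    F α x                 ∎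
  at-limit P {α} e IH _ x = begin
    A α x           ≡⟨ A-at-limit α e x ⟩
    A (fund α x) x  ≤⟨ IH x (fund≢𝟎 α x e) x ⟩
    F (fund α x) x  ≡⟨ F-at-limit α e x ⟨
    F α x           ∎

-- h x = 6x + 5: simulating the x + 1 steps of F_β in F_{β+1}(x) costs five A_β-steps each,
-- on top of the x steps from 1 that lift the argument of A_{β+1} above x.
h : ℕ → ℕ
h x = suc x * 5 + x

h≤16* : ∀ z → 1 ≤ z → h z ≤ 2 * (2 * (2 * (2 * z)))
h≤16* (suc z) _ = ≤-trans (m≤m+n (h (suc z)) (5 + 10 * z)) (≤-reflexive (sym (sixteen z)))
  where
  sixteen : ∀ z → 2 * (2 * (2 * (2 * suc z))) ≡ (suc (suc z) * 5 + suc z) + (5 + 10 * z)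
  sixteen = solve-∀

F≤A∘h-succ : ∀ α {β} → classify α ≡ succ β → β ≢ 𝟎 →
             (∀ y → F β y ≤ A β (h y)) → ∀ x → F α x ≤ A α (h x)
F≤A∘h-succ α {β} e β≢𝟎 IH x = begin
  F α x                                    ≡⟨ F-at-succ α e x ⟩
  fold x (F β) (suc x)                     ≤⟨ fold-simulation 5 Aβ-inflationary F-by-A₅ (suc x)
                                                (≤-trans (n≤1+n x) (fold-doubling-suc Aβ-doubling x))
                                                (≤-trans (s≤s z≤n) (fold-doubling-suc Aβ-doubling x)) ⟩
  fold (fold 1 (A β) x) (A β) (suc x * 5)  ≡⟨ fold-+ 1 (A β) (suc x * 5) ⟨
  fold 1 (A β) (h x)                       ≡⟨ A-at-succ α e β≢𝟎 (h x) ⟨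
  A α (h x)                                ∎
  where
  open ≤-Reasoning
  Aβ-doubling : ∀ y → 2 * y ≤ A β y
  Aβ-doubling = A-doubling (A-growth β β≢𝟎)
  Aβ-inflationary : ∀ y → y ≤ A β y
  Aβ-inflationary = doubling⇒inflationary Aβ-doubling
  Aβ-monotone : A β Preserves _≤_ ⟶ _≤_
  Aβ-monotone = A-monotone (A-growth β β≢𝟎) β≢𝟎 ⊑-refl
  F-by-A₅ : ∀ {y z} → y ≤ z → 1 ≤ z → F β y ≤ fold z (A β) 5
  F-by-A₅ {y} {z} y≤z 1≤z = begin
    F β y                 ≤⟨ F-monotone (F-growth β) ⊑-refl y≤z ⟩
    F β z                 ≤⟨ IH z ⟩
    A β (h z)             ≤⟨ Aβ-monotone (≤-trans (h≤16* z 1≤z) (fold-pointwise Aβ-doubling Aβ-monotone 4 ≤-refl)) ⟩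
    A β (fold z (A β) 4)  ∎

F≤A∘h : ∀ α → α ≢ 𝟎 → ∀ x → F α x ≤ A α (h x)
F≤A∘h = progressive-induction P
  where
  open ≤-Reasoning
  P : Progressive (λ α → α ≢ 𝟎 → ∀ x → F α x ≤ A α (h x))
  at-zero P 𝟎≢𝟎 = ⊥-elim (𝟎≢𝟎 refl)
  at-succ P {α} {𝟎} e _ _ x with classify≡succ𝟎⇒≡𝟏 α e
  ... | refl = begin
    F 𝟏 x                     ≡⟨ F-at-𝟏 x ⟩
    suc x + x                 ≤⟨ m≤m+n (suc x + x) (9 + 10 * x) ⟩
    suc x + x + (9 + 10 * x)  ≡⟨ twelve x ⟨
    2 * h x                   ≡⟨ A-at-𝟏 (h x) ⟨
    A 𝟏 (h x)                 ∎
    where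
    twelve : ∀ x → 2 * (suc x * 5 + x) ≡ suc x + x + (9 + 10 * x)
    twelve = solve-∀
  at-succ P {α} {ω^ _ + _} e IH _ = F≤A∘h-succ α e (λ ()) (IH (λ ()))
  at-limit P {α} e IH _ x = begin
    F α x                  ≡⟨ F-at-limit α e x ⟩
    F (fund α x) x         ≤⟨ IH x (fund≢𝟎 α x e) x ⟩
    A (fund α x) (h x)     ≤⟨ A-monotone (A-growth (fund α (h x)) (fund≢𝟎 α (h x) e)) (fund≢𝟎 α x e)
                                (fund-⊑-mono α e (m≤n+m x (suc x * 5))) ≤-refl ⟩
    A (fund α (h x)) (h x) ≡⟨ A-at-limit α e (h x) ⟨
    A α (h x)              ∎

Unary : OT → (ℕ → ℕ) → Set
Unary β f = Grz β 1 (λ v → f (head v))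

Unary-+ : ∀ {β f g} → Unary β f → Unary β g → Unary β (λ x → f x + g x)
Unary-+ {f = f} {g} Gf Gg = g-subst {gs = args} g-add λ { Fin.zero → Gf ; (Fin.suc Fin.zero) → Gg }
  where
  args : Fin 2 → Vec ℕ 1 → ℕ
  args Fin.zero v = f (head v)
  args (Fin.suc Fin.zero) v = g (head v)

Unary-* : ∀ {β f} n → Unary β f → Unary β (λ x → n * f x)
Unary-* zero Gf = g-zero
Unary-* {f = f} (suc n) Gf = Unary-+ {f = f} {λ x → n * f x} Gf (Unary-* {f = f} n Gf)

Unary-F∘ : ∀ {β f} → Unary β f → Unary β (λ x → F β (f x))
Unary-F∘ {β} Gf = g-subst (g-F (λ v → F β (head v)) (FG-F β)) (λ _ → Gf)

GrzBelow-dominates-h∘ : ∀ {α q} → GrzBelow α q → Σ (ℕ → ℕ) λ p → GrzBelow α p × (∀ x → h (q x) ≤ p x)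
GrzBelow-dominates-h∘ {q = q} (β , β-cnf , β<α , Gq) =
  p , (β , β-cnf , β<α , g-ext Gp λ { (x ∷ []) → refl }) , h∘q≤p
  where
  p : ℕ → ℕ
  p x = 6 * F β (q x)
  Gp : Unary β p
  Gp = Unary-* {f = λ x → F β (q x)} 6 (Unary-F∘ {f = q} (g-ext Gq λ { (x ∷ []) → refl }))
  h∘q≤p : ∀ x → h (q x) ≤ p x
  h∘q≤p x = begin
    h (q x)        ≤⟨ n≤1+n (h (q x)) ⟩
    suc (h (q x))  ≡⟨ six (q x) ⟨
    6 * suc (q x)  ≤⟨ *-monoʳ-≤ 6 (F-inflationary (F-growth β) (q x)) ⟩
    p x            ∎
    where
    open ≤-Reasoning
    six : ∀ y → 6 * suc y ≡ suc (suc y * 5 + y)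
    six = solve-∀

exec-mono : ∀ {k} (M : TM k) {t t' c b} → t ≤ t' → exec M t c ≡ just b → exec M t' c ≡ just b
exec-mono M {suc t} {suc t'} {c} (s≤s t≤t') halts with step M c
... | inj₁ _ = halts
... | inj₂ _ = exec-mono M t≤t' halts

DecidesWithin-mono : ∀ {k} (M : TM k) {L w t t'} → t ≤ t' → DecidesWithin M L w t → DecidesWithin M L w t'
DecidesWithin-mono M t≤t' (inj₁ (halts , w∈L)) = inj₁ (exec-mono M t≤t' halts , w∈L)
DecidesWithin-mono M t≤t' (inj₂ (halts , w∉L)) = inj₂ (exec-mono M t≤t' halts , w∉L)

DTime-mono : ∀ {k} {T T' : ℕ → ℕ → Set} {L : List (Fin k) → Set} →
             (∀ n {y} → T n y → Σ ℕ λ y' → T' n y' × y ≤ y') → DTime T L → DTime T' L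
DTime-mono {T = T} {T'} {L} bound (M , decides) = M , λ w → within w (decides w)
  where
  within : ∀ w → Σ ℕ (λ y → T (length w) y × DecidesWithin M L w y) →
           Σ ℕ (λ y' → T' (length w) y' × DecidesWithin M L w y')
  within w (y , t , dw) with bound (length w) t
  ... | y' , t' , y≤y' = y' , t' , DecidesWithin-mono M {L} y≤y' dw

𝟎<ₒ⇒≢𝟎 : ∀ {α} → 𝟎 <ₒ α → α ≢ 𝟎
𝟎<ₒ⇒≢𝟎 () refl

theorem4p1 : (α : OT) → CNF α → 𝟎 <ₒ α →
    (k : ℕ) (L : List (Fin k) → Set) → (𝐀 α L → 𝐅 α L) × (𝐅 α L → 𝐀 α L)
theorem4p1 α _ 𝟎<α k L = 𝐀⊆𝐅 , 𝐅⊆𝐀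
  where
  α≢𝟎 = 𝟎<ₒ⇒≢𝟎 𝟎<α
  𝐀⊆𝐅 : 𝐀 α L → 𝐅 α L
  𝐀⊆𝐅 (p , p∈𝓕<α , decided) = p , p∈𝓕<α , DTime-mono bound decided
    where
    bound : ∀ n {y} → AG α (p n) y → Σ ℕ λ y' → FG α (p n) y' × y ≤ y'
    bound n ag = F α (p n) , FG-F α (p n) ,
      subst (_≤ F α (p n)) (sym (AG⇒≡A α (p n) ag)) (A≤F α α≢𝟎 (p n))
  𝐅⊆𝐀 : 𝐅 α L → 𝐀 α L
  𝐅⊆𝐀 (q , q∈𝓕<α , decided) with GrzBelow-dominates-h∘ q∈𝓕<α
  ... | p , p∈𝓕<α , h∘q≤p = p , p∈𝓕<α , DTime-mono bound decided
    where
    bound : ∀ n {y} → FG α (q n) y → Σ ℕ λ y' → AG α (p n) y' × y ≤ y'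
    bound n fg = A α (p n) , AG-A α≢𝟎 (p n) ,
      subst (_≤ A α (p n)) (sym (FG⇒≡F α (q n) fg))
        (≤-trans (F≤A∘h α α≢𝟎 (q n)) (A-monotone (A-growth α α≢𝟎) α≢𝟎 ⊑-refl (h∘q≤p n)))
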